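{- Let $u$ and $v$ be two cyclic binary words of length $n$. If $n_{0,u}\neq n_{0,v}$ or $n_{1,u}\neq n_{1,v}$ or $l_u\neq l_v$, then there exists a distinguishing subword of length at most $\frac34 n+4$ for $u$ and $v$.
   Context: The alphabet is $\{0,1\}$. A cyclic word is an equivalence class of finite words under conjugacy; its length is that of a representative. If a cyclic word $w$ has representative $w_1\cdots w_n$, a subword of $w$ is any cyclic word with a representative $w_{i_1}\cdots w_{i_k}$, $1\le i_1<\dots<i_k\le n$. A distinguishing subword for $u,v$ is a cyclic word which is a subword of exactly one of $u,v$. For a cyclic word $w$: $n_{0,w}$, $n_{1,w}$ are the numbers of 0's and 1's; a block of 0's is a maximal cyclically-consecutive run of 0's bounded by 1's on both sides; $l_w$ is the number of blocks of 0's of $w$. -}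

module Defs where

open import Data.Bool using (Bool; true; false)
open import Data.List using (List; []; _∷_; _++_; length; [_]; zip; filter; map)
open import Data.List.Relation.Binary.Sublist.Propositional using (_⊆_)
open import Data.Nat using (ℕ; zero; suc)
open import Data.Product using (_×_; _,_; ∃₂)
open import Data.Sum using (_⊎_)
open import Relation.Binary.PropositionalEquality using (_≡_)
open import Relation.Nullary using (¬_)

-- Binary alphabet {0,1}: the letter 0 is `false`, the letter 1 is `true`.
-- A cyclic word is represented by any of its representatives (a List Bool);
-- all notions below are defined on representatives and respect conjugacy.
Word : Set
Word = List Bool

Conj : Word → Word → Set
Conj a b = ∃₂ λ p q → (a ≡ p ++ q) × (b ≡ q ++ p)

-- x is a subword of the cyclic word w: some representative of (the cyclic
-- word of) x is a scattered subsequence w_{i1}...w_{ik} of the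
-- representative w = w_1...w_n.  (Independent of the chosen representative.)
IsSubword : Word → Word → Set
IsSubword x w = ∃₂ λ p q → (x ≡ p ++ q) × ((q ++ p) ⊆ w)

Distinguishing : Word → Word → Word → Set
Distinguishing x u v = (IsSubword x u × ¬ IsSubword x v) ⊎ (IsSubword x v × ¬ IsSubword x u)

count : Bool → Word → ℕ
count b [] = zero
count true  (true  ∷ w) = suc (count true w)
count false (false ∷ w) = suc (count false w)
count true  (false ∷ w) = count true w
count false (true  ∷ w) = count false w

n0 : Word → ℕ
n0 = count false

n1 : Word → ℕ
n1 = count true

rotate1 : Word → Word
rotate1 [] = []
rotate1 (x ∷ xs) = xs ++ [ x ]

count10 : List (Bool × Bool) → ℕ
count10 [] = zero
count10 ((true , false) ∷ ps) = suc (count10 ps)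
count10 ((true , true) ∷ ps) = count10 ps
count10 ((false , _) ∷ ps) = count10 ps

-- l_w: the number of blocks of 0's (maximal cyclic runs of 0's bounded by 1's).
-- Each such block is uniquely determined by the cyclic position i with
-- w_i = 1 and w_{i+1} = 0 (indices mod n) where it begins; the all-0 word
-- (no bounding 1's) has no blocks.
blocks0 : Word → ℕ
blocks0 w = count10 (zip w (rotate1 w))

-- Letter counts. If n0 u < n0 v, then 0^(n0 u + 1) is a subword of v only and
-- 1^(n1 v + 1) a subword of u only; as n0 u + n1 v < n, one of them is short.
--
-- A block of 0's is marked by the factor 10 at its left end, so l_w counts the
-- falls 10 of the cyclic word; deleting a letter c between b and d replaces the falls of bcd
-- by those of bd, losing at most one. Hence a subword x of w has at least
-- l_w - (|w| - |x|) blocks. Let l_u < l_v and, complementing both words if needed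
-- (which preserves the number of blocks), n0 u ≤ n / 2. If l_u ≤ (3n + 8) / 8, the word
-- (10)^(l_u + 1) is a subword of v only. Otherwise delete every isolated 0 of u: the result
-- x loses exactly one block per deleted letter, hence is not a subword of v, and since each
-- remaining block has at least two 0's, |x| ≤ n + n0 u - 2 l_u < 3n / 4.
module Submission where

open import Data.List using (length)
open import Data.Nat using (ℕ; _*_; _+_; _≤_)
open import Data.Product using (∃; _×_)
open import Data.Sum using (_⊎_)
open import Relation.Binary.PropositionalEquality using (_≡_; _≢_)

open import Defs
open import Data.Bool using (Bool; true; false; not)
open import Data.Bool.Properties using (not-involutive)
open import Data.List using ([]; _∷_; _++_; [_]; zip; map; replicate)
open import Data.List.Properties
  using (++-assoc; ++-identityʳ; length-++; length-map; length-replicate;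
         map-++; map-∘; map-id; map-cong)
open import Data.List.Relation.Binary.Sublist.Propositional
  using (_⊆_; []; _∷_; _∷ʳ_; ⊆-refl; minimum)
open import Data.List.Relation.Binary.Sublist.Propositional.Properties
  using (++⁺; ++⁺ʳ; map⁺)
open import Data.Nat using (zero; suc; _<_; z≤n; s≤s; _≤?_)
open import Data.Nat.Properties
open import Data.Nat.Tactic.RingSolver using (solve)
open import Algebra.Properties.CommutativeSemigroup +-commutativeSemigroup using (x∙yz≈y∙xz)
open import Data.Product using (∃₂; _,_)
open import Data.Sum using (inj₁; inj₂)
open import Function using (_∘_)
open import Relation.Binary.Definitions using (tri<; tri≈; tri>)
open import Relation.Binary.PropositionalEquality
  using (refl; sym; trans; cong; subst; subst₂; module ≡-Reasoning)
open import Relation.Nullary using (¬_; yes; no; contradiction)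

private
  variable
    c : Bool
    x y z w : Word

-- Falls, blocks and letter counts

fall : Bool → Bool → ℕ
fall true false = 1
fall _    _     = 0

falls : Bool → Word → Bool → ℕ
falls b []      e = fall b e
falls b (c ∷ w) e = fall b c + falls c w e

count10-∷ : ∀ b c ps → count10 ((b , c) ∷ ps) ≡ fall b c + count10 ps
count10-∷ true  true  ps = refl
count10-∷ true  false ps = refl
count10-∷ false true  ps = refl
count10-∷ false false ps = refl

count10-zip : ∀ b w e → count10 (zip (b ∷ w) (w ++ [ e ])) ≡ falls b w e
count10-zip b []      e = trans (count10-∷ b e []) (+-identityʳ (fall b e))
count10-zip b (c ∷ w) e = trans (count10-∷ b c _) (cong (fall b c +_) (count10-zip c w e))

blocks0-∷ : ∀ h t → blocks0 (h ∷ t) ≡ falls h t h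
blocks0-∷ h t = count10-zip h t h

falls-∷ʳ : ∀ b w c e → falls b (w ++ [ c ]) e ≡ falls b w c + fall c e
falls-∷ʳ b []      c e = refl
falls-∷ʳ b (d ∷ w) c e =
  trans (cong (fall b d +_) (falls-∷ʳ d w c e)) (sym (+-assoc (fall b d) _ _))

RotationInvariant : (Word → ℕ) → Set
RotationInvariant f = ∀ p q → f (p ++ q) ≡ f (q ++ p)

blocks0-rotate₁ : ∀ h t → blocks0 (h ∷ t) ≡ blocks0 (t ++ [ h ])
blocks0-rotate₁ h []      = refl
blocks0-rotate₁ h (c ∷ t) = begin
  blocks0 (h ∷ c ∷ t)     ≡⟨ blocks0-∷ h (c ∷ t) ⟩
  fall h c + falls c t h  ≡⟨ +-comm (fall h c) _ ⟩
  falls c t h + fall h c  ≡⟨ sym (falls-∷ʳ c t h c) ⟩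
  falls c (t ++ [ h ]) c  ≡⟨ sym (blocks0-∷ c (t ++ [ h ])) ⟩
  blocks0 (c ∷ t ++ [ h ]) ∎
  where open ≡-Reasoning

blocks0-rotate : RotationInvariant blocks0
blocks0-rotate []      q = cong blocks0 (sym (++-identityʳ q))
blocks0-rotate (h ∷ p) q = begin
  blocks0 (h ∷ p ++ q)         ≡⟨ blocks0-rotate₁ h (p ++ q) ⟩
  blocks0 ((p ++ q) ++ [ h ])  ≡⟨ cong blocks0 (++-assoc p q [ h ]) ⟩
  blocks0 (p ++ q ++ [ h ])    ≡⟨ blocks0-rotate p (q ++ [ h ]) ⟩
  blocks0 ((q ++ [ h ]) ++ p)  ≡⟨ cong blocks0 (++-assoc q [ h ] p) ⟩
  blocks0 (q ++ h ∷ p)         ∎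
  where open ≡-Reasoning

count-++ : ∀ c (p q : Word) → count c (p ++ q) ≡ count c p + count c q
count-++ c     []          q = refl
count-++ true  (true  ∷ p) q = cong suc (count-++ true p q)
count-++ true  (false ∷ p) q = count-++ true p q
count-++ false (true  ∷ p) q = count-++ false p q
count-++ false (false ∷ p) q = cong suc (count-++ false p q)

count-rotate : ∀ c → RotationInvariant (count c)
count-rotate c p q =
  trans (count-++ c p q) (trans (+-comm (count c p) _) (sym (count-++ c q p)))

length-rotate : RotationInvariant length
length-rotate p q = trans (length-++ p) (trans (+-comm (length p) _) (sym (length-++ q)))

n0+n1≡length : ∀ w → n0 w + n1 w ≡ length w
n0+n1≡length []          = refl
n0+n1≡length (true  ∷ w) = trans (+-suc (n0 w) (n1 w)) (cong suc (n0+n1≡length w))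
n0+n1≡length (false ∷ w) = cong suc (n0+n1≡length w)

count-mono-⊆ : ∀ c {y w : Word} → y ⊆ w → count c y ≤ count c w
count-mono-⊆ c     []                             = z≤n
count-mono-⊆ true  (true  ∷ʳ s)                   = m≤n⇒m≤1+n (count-mono-⊆ true s)
count-mono-⊆ true  (false ∷ʳ s)                   = count-mono-⊆ true s
count-mono-⊆ false (true  ∷ʳ s)                   = count-mono-⊆ false s
count-mono-⊆ false (false ∷ʳ s)                   = m≤n⇒m≤1+n (count-mono-⊆ false s)
count-mono-⊆ true  {w = true  ∷ _} (refl ∷ s) = s≤s (count-mono-⊆ true s)
count-mono-⊆ true  {w = false ∷ _} (refl ∷ s) = count-mono-⊆ true s
count-mono-⊆ false {w = true  ∷ _} (refl ∷ s) = count-mono-⊆ false s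
count-mono-⊆ false {w = false ∷ _} (refl ∷ s) = s≤s (count-mono-⊆ false s)

-- Subwords

fall-triangle : ∀ b c d → fall b d ≤ fall b c + fall c d
fall-triangle true  true  d     = ≤-refl
fall-triangle true  false true  = z≤n
fall-triangle true  false false = s≤s z≤n
fall-triangle false c     d     = z≤n

fall-detour : ∀ b c d → fall b c + fall c d ≤ suc (fall b d)
fall-detour true  true  true  = z≤n
fall-detour true  true  false = s≤s z≤n
fall-detour true  false true  = ≤-refl
fall-detour true  false false = s≤s z≤n
fall-detour false true  true  = z≤n
fall-detour false true  false = ≤-refl
fall-detour false false d     = z≤n

falls≤fall+falls : ∀ b c y e → falls b y e ≤ fall b c + falls c y e
falls≤fall+falls b c []      e = fall-triangle b c e
falls≤fall+falls b c (d ∷ y) e = begin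
  fall b d + falls d y e               ≤⟨ +-monoˡ-≤ (falls d y e) (fall-triangle b c d) ⟩
  fall b c + fall c d + falls d y e    ≡⟨ +-assoc (fall b c) _ _ ⟩
  fall b c + (fall c d + falls d y e)  ∎
  where open ≤-Reasoning

fall+falls≤1+falls : ∀ b c y e → fall b c + falls c y e ≤ suc (falls b y e)
fall+falls≤1+falls b c []      e = fall-detour b c e
fall+falls≤1+falls b c (d ∷ y) e = begin
  fall b c + (fall c d + falls d y e)  ≡⟨ +-assoc (fall b c) _ _ ⟨
  fall b c + fall c d + falls d y e    ≤⟨ +-monoˡ-≤ (falls d y e) (fall-detour b c d) ⟩
  suc (fall b d + falls d y e)         ∎
  where open ≤-Reasoning

falls-mono-⊆ : y ⊆ z → ∀ b e → falls b y e ≤ falls b z e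
falls-mono-⊆ []                b e = ≤-refl
falls-mono-⊆ {y} (c ∷ʳ s)      b e =
  ≤-trans (falls≤fall+falls b c y e) (+-monoʳ-≤ (fall b c) (falls-mono-⊆ s c e))
falls-mono-⊆ (_∷_ {x = c} refl s) b e = +-monoʳ-≤ (fall b c) (falls-mono-⊆ s c e)

falls-⊆-defect : y ⊆ z → ∀ b e → length y + falls b z e ≤ length z + falls b y e
falls-⊆-defect []                b e = ≤-refl
falls-⊆-defect {y} {_ ∷ z} (c ∷ʳ s) b e = begin
  length y + (fall b c + falls c z e)  ≡⟨ x∙yz≈y∙xz (length y) (fall b c) _ ⟩
  fall b c + (length y + falls c z e)  ≤⟨ +-monoʳ-≤ (fall b c) (falls-⊆-defect s c e) ⟩
  fall b c + (length z + falls c y e)  ≡⟨ x∙yz≈y∙xz (fall b c) (length z) _ ⟩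
  length z + (fall b c + falls c y e)  ≤⟨ +-monoʳ-≤ (length z) (fall+falls≤1+falls b c y e) ⟩
  length z + suc (falls b y e)         ≡⟨ +-suc (length z) _ ⟩
  suc (length z + falls b y e)         ∎
  where open ≤-Reasoning
falls-⊆-defect {_ ∷ y} {_ ∷ z} (_∷_ {x = c} refl s) b e = s≤s (begin
  length y + (fall b c + falls c z e)  ≡⟨ x∙yz≈y∙xz (length y) (fall b c) _ ⟩
  fall b c + (length y + falls c z e)  ≤⟨ +-monoʳ-≤ (fall b c) (falls-⊆-defect s c e) ⟩
  fall b c + (length z + falls c y e)  ≡⟨ x∙yz≈y∙xz (fall b c) (length z) _ ⟩
  length z + (fall b c + falls c y e)  ∎)
  where open ≤-Reasoning

∷-⊆-decompose : (c ∷ y) ⊆ w → ∃₂ λ A B → (w ≡ A ++ c ∷ B) × (y ⊆ B)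
∷-⊆-decompose {w = d ∷ w} (.d ∷ʳ s) with ∷-⊆-decompose s
... | A , B , refl , y⊆B = d ∷ A , B , refl , y⊆B
∷-⊆-decompose {w = d ∷ w} (refl ∷ s) = [] , w , refl , s

n1≡0⊎∃occurrence : ∀ w → n1 w ≡ 0 ⊎ ∃₂ λ A B → w ≡ A ++ true ∷ B
n1≡0⊎∃occurrence []          = inj₁ refl
n1≡0⊎∃occurrence (true  ∷ w) = inj₂ ([] , w , refl)
n1≡0⊎∃occurrence (false ∷ w) with n1≡0⊎∃occurrence w
... | inj₁ n1≡0           = inj₁ n1≡0
... | inj₂ (A , B , refl) = inj₂ (false ∷ A , B , refl)

⊆-++-split : ∀ P Q → y ⊆ P ++ Q → ∃₂ λ y₁ y₂ → (y ≡ y₁ ++ y₂) × (y₁ ⊆ P) × (y₂ ⊆ Q)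
⊆-++-split []      Q s          = [] , _ , refl , [] , s
⊆-++-split (d ∷ P) Q (.d ∷ʳ s) with ⊆-++-split P Q s
... | y₁ , y₂ , refl , s₁ , s₂ = y₁ , y₂ , refl , d ∷ʳ s₁ , s₂
⊆-++-split (d ∷ P) Q (refl ∷ s) with ⊆-++-split P Q s
... | y₁ , y₂ , refl , s₁ , s₂ = d ∷ y₁ , y₂ , refl , refl ∷ s₁ , s₂

⊆⇒subword : y ⊆ w → IsSubword y w
⊆⇒subword {y} s = y , [] , sym (++-identityʳ y) , s

⊆-rotation⇒subword : ∀ p q → y ⊆ q ++ p → IsSubword y (p ++ q)
⊆-rotation⇒subword p q s with ⊆-++-split q p s
... | y₁ , y₂ , refl , s₁ , s₂ = y₁ , y₂ , refl , ++⁺ s₂ s₁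

falls≤n1 : ∀ b w e → falls b w e ≤ n1 (b ∷ w)
falls≤n1 true  []          true  = z≤n
falls≤n1 true  []          false = ≤-refl
falls≤n1 false []          e     = z≤n
falls≤n1 true  (true  ∷ w) e     = m≤n⇒m≤1+n (falls≤n1 true w e)
falls≤n1 true  (false ∷ w) e     = s≤s (falls≤n1 false w e)
falls≤n1 false (c ∷ w)     e     = falls≤n1 c w e

blocks0≤n1 : ∀ w → blocks0 w ≤ n1 w
blocks0≤n1 []      = z≤n
blocks0≤n1 (h ∷ t) = subst (_≤ n1 (h ∷ t)) (sym (blocks0-∷ h t)) (falls≤n1 h t h)

blocks0≤length : ∀ w → blocks0 w ≤ length w
blocks0≤length w =
  ≤-trans (blocks0≤n1 w) (≤-trans (m≤n+m (n1 w) (n0 w)) (≤-reflexive (n0+n1≡length w)))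

blocks0-mono-⊆ : y ⊆ w → blocks0 y ≤ blocks0 w
blocks0-mono-⊆ {[]}    s = z≤n
blocks0-mono-⊆ {c ∷ y} s with ∷-⊆-decompose s
... | A , B , refl , y⊆B
  rewrite blocks0-rotate A (c ∷ B) | blocks0-∷ c (B ++ A) | blocks0-∷ c y =
  falls-mono-⊆ (++⁺ʳ A y⊆B) c c

blocks0-⊆-defect : y ⊆ w → length y + blocks0 w ≤ length w + blocks0 y
blocks0-⊆-defect {[]} {w} s =
  ≤-trans (blocks0≤length w) (≤-reflexive (sym (+-identityʳ (length w))))
blocks0-⊆-defect {c ∷ y} s with ∷-⊆-decompose s
... | A , B , refl , y⊆B
  rewrite blocks0-rotate A (c ∷ B) | length-rotate A (c ∷ B)
        | blocks0-∷ c (B ++ A) | blocks0-∷ c y =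
  s≤s (falls-⊆-defect (++⁺ʳ A y⊆B) c c)

subword-mono : ∀ {f} → RotationInvariant f → (∀ {y w} → y ⊆ w → f y ≤ f w) →
               IsSubword x w → f x ≤ f w
subword-mono inv mono (p , q , refl , s) = ≤-trans (≤-reflexive (inv p q)) (mono s)

blocks0-subword-defect : IsSubword x w → length x + blocks0 w ≤ length w + blocks0 x
blocks0-subword-defect (p , q , refl , s)
  rewrite length-rotate p q | blocks0-rotate p q = blocks0-⊆-defect s

-- Powers and alternating words

replicate-⊆ : ∀ c m w → m ≤ count c w → replicate m c ⊆ w
replicate-⊆ c     zero    w           _       = minimum w
replicate-⊆ true  (suc m) (true  ∷ w) (s≤s h) = refl ∷ replicate-⊆ true m w h
replicate-⊆ true  (suc m) (false ∷ w) h       = false ∷ʳ replicate-⊆ true (suc m) w h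
replicate-⊆ false (suc m) (false ∷ w) (s≤s h) = refl ∷ replicate-⊆ false m w h
replicate-⊆ false (suc m) (true  ∷ w) h       = true ∷ʳ replicate-⊆ false (suc m) w h

count-replicate : ∀ c m → count c (replicate m c) ≡ m
count-replicate c     zero    = refl
count-replicate true  (suc m) = cong suc (count-replicate true m)
count-replicate false (suc m) = cong suc (count-replicate false m)

power-distinguishes : ∀ c {u v} → count c u < count c v →
                      Distinguishing (replicate (suc (count c u)) c) u v
power-distinguishes c {u} {v} lt = inj₂ (⊆⇒subword (replicate-⊆ c _ v lt) , not-in-u)
  where
  not-in-u : ¬ IsSubword (replicate (suc (count c u)) c) u
  not-in-u s = 1+n≰n (subst (_≤ count c u) (count-replicate c (suc (count c u)))
                            (subword-mono (count-rotate c) (count-mono-⊆ c) s))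

alternating : ℕ → Word
alternating zero    = []
alternating (suc m) = true ∷ false ∷ alternating m

length-alternating : ∀ m → length (alternating m) ≡ m + m
length-alternating zero    = refl
length-alternating (suc m) =
  cong suc (trans (cong suc (length-alternating m)) (sym (+-suc m m)))

blocks0-alternating : ∀ m → blocks0 (alternating m) ≡ m
blocks0-alternating zero    = refl
blocks0-alternating (suc m) =
  trans (blocks0-∷ true (false ∷ alternating m)) (cong suc (falls-alternating m))
  where
  falls-alternating : ∀ m → falls false (alternating m) true ≡ m
  falls-alternating zero    = refl
  falls-alternating (suc m) = cong suc (falls-alternating m)

-- The two lemmas track whether the letter before w is a 1 or a 0.
alternating-⊆-1∷ : ∀ m w → m ≤ falls true w true → alternating m ⊆ true ∷ w
alternating-⊆   : ∀ m w → m ≤ falls false w true → alternating m ⊆ w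
alternating-⊆-1∷ zero    w           _       = minimum _
alternating-⊆-1∷ (suc m) []          ()
alternating-⊆-1∷ (suc m) (true  ∷ w) h       = true ∷ʳ alternating-⊆-1∷ (suc m) w h
alternating-⊆-1∷ (suc m) (false ∷ w) (s≤s h) = refl ∷ refl ∷ alternating-⊆ m w h
alternating-⊆   zero    w           _ = minimum w
alternating-⊆   (suc m) []          ()
alternating-⊆   (suc m) (false ∷ w) h = false ∷ʳ alternating-⊆ (suc m) w h
alternating-⊆   (suc m) (true  ∷ w) h = alternating-⊆-1∷ (suc m) w h

alternating-subword : ∀ m w → m ≤ blocks0 w → IsSubword (alternating m) w
alternating-subword m w h with n1≡0⊎∃occurrence w
... | inj₁ n1≡0 rewrite n≤0⇒n≡0 (≤-trans h (subst (blocks0 w ≤_) n1≡0 (blocks0≤n1 w))) =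
  ⊆⇒subword (minimum w)
... | inj₂ (A , B , refl) = ⊆-rotation⇒subword A (true ∷ B) (alternating-⊆-1∷ m (B ++ A) h′)
  where
  h′ : m ≤ falls true (B ++ A) true
  h′ = subst (m ≤_) (trans (blocks0-rotate A (true ∷ B)) (blocks0-∷ true (B ++ A))) h

-- Deleting the isolated 0's

-- The flag is true when the previous letter is a 1, and the word is read cyclically
-- after a 1, so a 0 at the very end is followed by that 1.
dropIsolated0 : Bool → Word → Word
dropIsolated0 _     []                  = []
dropIsolated0 true  (false ∷ [])        = []
dropIsolated0 true  (false ∷ true ∷ r)  = true ∷ dropIsolated0 true r
dropIsolated0 true  (false ∷ false ∷ r) = false ∷ dropIsolated0 false (false ∷ r)
dropIsolated0 false (false ∷ r)         = false ∷ dropIsolated0 false r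
dropIsolated0 _     (true ∷ r)          = true ∷ dropIsolated0 true r

dropIsolated0-⊆ : ∀ b r → dropIsolated0 b r ⊆ r
dropIsolated0-⊆ _     []                  = []
dropIsolated0-⊆ true  (false ∷ [])        = false ∷ʳ []
dropIsolated0-⊆ true  (false ∷ true ∷ r)  = false ∷ʳ refl ∷ dropIsolated0-⊆ true r
dropIsolated0-⊆ true  (false ∷ false ∷ r) = refl ∷ dropIsolated0-⊆ false (false ∷ r)
dropIsolated0-⊆ false (false ∷ r)         = refl ∷ dropIsolated0-⊆ false r
dropIsolated0-⊆ true  (true ∷ r)          = refl ∷ dropIsolated0-⊆ true r
dropIsolated0-⊆ false (true ∷ r)          = refl ∷ dropIsolated0-⊆ true r

+-suc-mono-≤ : ∀ a b c d → a + b ≤ c + d → a + suc b ≤ c + suc d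
+-suc-mono-≤ a b c d h rewrite +-suc a b | +-suc c d = s≤s h

dropIsolated0-defect : ∀ b r →
  length r + falls b (dropIsolated0 b r) true ≤ length (dropIsolated0 b r) + falls b r true
dropIsolated0-defect _     []                  = ≤-refl
dropIsolated0-defect true  (false ∷ [])        = ≤-refl
dropIsolated0-defect true  (false ∷ true ∷ r)  =
  s≤s (≤-trans (s≤s (dropIsolated0-defect true r)) (≤-reflexive (sym (+-suc _ _))))
dropIsolated0-defect true  (false ∷ false ∷ r) =
  s≤s (s≤s (+-suc-mono-≤ _ _ _ _ (dropIsolated0-defect false r)))
dropIsolated0-defect false (false ∷ r)         = s≤s (dropIsolated0-defect false r)
dropIsolated0-defect true  (true ∷ r)          = s≤s (dropIsolated0-defect true r)
dropIsolated0-defect false (true ∷ r)          = s≤s (dropIsolated0-defect true r)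

-- A block of r survives the deletion only if it has at least two 0's.
falls+falls-dropIsolated0≤n0 : ∀ b r →
  falls b r true + falls b (dropIsolated0 b r) true ≤ n0 r
falls+falls-dropIsolated0≤n0 true  []                  = z≤n
falls+falls-dropIsolated0≤n0 false []                  = z≤n
falls+falls-dropIsolated0≤n0 true  (false ∷ [])        = ≤-refl
falls+falls-dropIsolated0≤n0 true  (false ∷ true ∷ r)  =
  s≤s (falls+falls-dropIsolated0≤n0 true r)
falls+falls-dropIsolated0≤n0 true  (false ∷ false ∷ r) =
  s≤s (≤-trans (≤-reflexive (+-suc _ _)) (s≤s (falls+falls-dropIsolated0≤n0 false r)))
falls+falls-dropIsolated0≤n0 false (false ∷ r)         =
  m≤n⇒m≤1+n (falls+falls-dropIsolated0≤n0 false r)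
falls+falls-dropIsolated0≤n0 true  (true ∷ r)          = falls+falls-dropIsolated0≤n0 true r
falls+falls-dropIsolated0≤n0 false (true ∷ r)          = falls+falls-dropIsolated0≤n0 true r

record SparseSubword (w : Word) : Set where
  field
    word       : Word
    subword    : IsSubword word w
    defect     : length w + blocks0 word ≤ length word + blocks0 w
    blocks-≤n0 : blocks0 w + blocks0 word ≤ n0 w

sparseSubword : ∀ w → SparseSubword w
sparseSubword w with n1≡0⊎∃occurrence w
... | inj₁ n1≡0 = record
  { word       = w
  ; subword    = ⊆⇒subword ⊆-refl
  ; defect     = ≤-refl
  ; blocks-≤n0 = blocks-≤n0
  }
  where
  blocks-≤n0 : blocks0 w + blocks0 w ≤ n0 w
  blocks-≤n0 rewrite n≤0⇒n≡0 (subst (blocks0 w ≤_) n1≡0 (blocks0≤n1 w)) = z≤n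
... | inj₂ (A , B , refl) = record
  { word       = true ∷ d
  ; subword    = ⊆-rotation⇒subword A (true ∷ B) (refl ∷ dropIsolated0-⊆ true t)
  ; defect     = defect
  ; blocks-≤n0 = blocks-≤n0
  }
  where
  t = B ++ A
  d = dropIsolated0 true t
  blocks0-w : blocks0 (A ++ true ∷ B) ≡ falls true t true
  blocks0-w = trans (blocks0-rotate A (true ∷ B)) (blocks0-∷ true t)
  defect : length (A ++ true ∷ B) + blocks0 (true ∷ d) ≤ suc (length d) + blocks0 (A ++ true ∷ B)
  defect rewrite blocks0-w | length-rotate A (true ∷ B) | blocks0-∷ true d =
    s≤s (dropIsolated0-defect true t)
  blocks-≤n0 : blocks0 (A ++ true ∷ B) + blocks0 (true ∷ d) ≤ n0 (A ++ true ∷ B)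
  blocks-≤n0 rewrite blocks0-w | count-rotate false A (true ∷ B) | blocks0-∷ true d =
    falls+falls-dropIsolated0≤n0 true t

-- Complement

complement : Word → Word
complement = map not

complement-involutive : ∀ w → complement (complement w) ≡ w
complement-involutive w = trans (sym (map-∘ w)) (trans (map-cong not-involutive w) (map-id w))

length-complement : ∀ w → length (complement w) ≡ length w
length-complement = length-map not

n0-complement : ∀ w → n0 (complement w) ≡ n1 w
n0-complement []          = refl
n0-complement (true  ∷ w) = cong suc (n0-complement w)
n0-complement (false ∷ w) = n0-complement w

complement-subword : IsSubword x w → IsSubword (complement x) (complement w)
complement-subword {w = w} (p , q , refl , s) =
  complement p , complement q , map-++ not p q ,
  subst (_⊆ complement w) (map-++ not q p) (map⁺ not s)

subword-complementˡ : IsSubword x (complement w) → IsSubword (complement x) w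
subword-complementˡ {x} {w} s =
  subst (IsSubword (complement x)) (complement-involutive w) (complement-subword s)

subword-complementʳ : IsSubword (complement x) w → IsSubword x (complement w)
subword-complementʳ {x} s =
  subst (λ x′ → IsSubword x′ _) (complement-involutive x) (complement-subword s)

distinguishing-complement : ∀ {u v} → Distinguishing x (complement u) (complement v) →
                            Distinguishing (complement x) u v
distinguishing-complement (inj₁ (s , ¬s)) = inj₁ (subword-complementˡ s , ¬s ∘ subword-complementʳ)
distinguishing-complement (inj₂ (s , ¬s)) = inj₂ (subword-complementˡ s , ¬s ∘ subword-complementʳ)

fall-complement : ∀ b c → fall (not b) (not c) + n1 [ b ] ≡ fall b c + n1 [ c ]
fall-complement true  true  = refl
fall-complement true  false = refl
fall-complement false true  = refl
fall-complement false false = refl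

-- Along a path from b to e the falls and the rises differ by [b = 1] - [e = 1].
falls-complement : ∀ b w e →
  falls (not b) (complement w) (not e) + n1 [ b ] ≡ falls b w e + n1 [ e ]
falls-complement b []      e = fall-complement b e
falls-complement b (c ∷ w) e = begin
  (a + X) + n1 [ b ]                   ≡⟨ +-assoc a X _ ⟩
  a + (X + n1 [ b ])                   ≡⟨ x∙yz≈y∙xz a X _ ⟩
  X + (a + n1 [ b ])                   ≡⟨ cong (X +_) (fall-complement b c) ⟩
  X + (fall b c + n1 [ c ])            ≡⟨ x∙yz≈y∙xz X (fall b c) _ ⟩
  fall b c + (X + n1 [ c ])            ≡⟨ cong (fall b c +_) (falls-complement c w e) ⟩
  fall b c + (falls c w e + n1 [ e ])  ≡⟨ +-assoc (fall b c) _ _ ⟨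
  (fall b c + falls c w e) + n1 [ e ]  ∎
  where
  open ≡-Reasoning
  a = fall (not b) (not c)
  X = falls (not c) (complement w) (not e)

blocks0-complement : ∀ w → blocks0 (complement w) ≡ blocks0 w
blocks0-complement []      = refl
blocks0-complement (h ∷ t) = begin
  blocks0 (not h ∷ complement t)          ≡⟨ blocks0-∷ (not h) (complement t) ⟩
  falls (not h) (complement t) (not h)    ≡⟨ +-cancelʳ-≡ _ _ _ (falls-complement h t h) ⟩
  falls h t h                             ≡⟨ blocks0-∷ h t ⟨
  blocks0 (h ∷ t)                         ∎
  where open ≡-Reasoning

power-length-bound : ∀ k n → k + suc k ≤ n → 4 * suc k ≤ 3 * n + 16
power-length-bound k n h = begin
  4 * suc k                    ≡⟨ solve (k ∷ []) ⟩
  (k + suc k) + (k + suc k) + 2 ≤⟨ +-monoˡ-≤ 2 (+-mono-≤ h h) ⟩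
  n + n + 2                    ≤⟨ m≤m+n (n + n + 2) (n + 14) ⟩
  n + n + 2 + (n + 14)         ≡⟨ solve (n ∷ []) ⟩
  3 * n + 16                   ∎
  where open ≤-Reasoning

alternating-length-bound : ∀ l n → 8 * l ≤ 3 * n + 8 → 4 * length (alternating (suc l)) ≤ 3 * n + 16
alternating-length-bound l n h = begin
  4 * length (alternating (suc l)) ≡⟨ cong (4 *_) (length-alternating (suc l)) ⟩
  4 * (suc l + suc l)              ≡⟨ solve (l ∷ []) ⟩
  8 * l + 8                        ≤⟨ +-monoˡ-≤ 8 h ⟩
  3 * n + 8 + 8                    ≡⟨ +-assoc (3 * n) 8 8 ⟩
  3 * n + 16                       ∎
  where open ≤-Reasoning

sparse-length-bound : ∀ {X l B z n} → X + l ≤ n + B → l + B ≤ z → z + z ≤ n → 3 * n + 8 < 8 * l →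
                      4 * X ≤ 3 * n + 16
sparse-length-bound {X} {l} {B} {z} {n} defect blocks≤z z+z≤n many-blocks =
  ≤-trans (m≤m+n (4 * X) 9)
    (≤-trans (+-cancelʳ-≤ (3 * n) (4 * X + 9) (3 * n) key) (m≤m+n (3 * n) 16))
  where
  open ≤-Reasoning
  key : 4 * X + 9 + 3 * n ≤ 3 * n + 3 * n
  key = begin
    4 * X + 9 + 3 * n        ≡⟨ solve (X ∷ n ∷ []) ⟩
    4 * X + suc (3 * n + 8)  ≤⟨ +-monoʳ-≤ (4 * X) many-blocks ⟩
    4 * X + 8 * l            ≡⟨ solve (X ∷ l ∷ []) ⟩
    4 * (X + l) + 4 * l      ≤⟨ +-monoˡ-≤ (4 * l) (*-monoʳ-≤ 4 defect) ⟩
    4 * (n + B) + 4 * l      ≡⟨ solve (n ∷ B ∷ l ∷ []) ⟩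
    4 * n + 4 * (l + B)      ≤⟨ +-monoʳ-≤ (4 * n) (*-monoʳ-≤ 4 blocks≤z) ⟩
    4 * n + 4 * z            ≡⟨ solve (n ∷ z ∷ []) ⟩
    4 * n + 2 * (z + z)      ≤⟨ +-monoʳ-≤ (4 * n) (*-monoʳ-≤ 2 z+z≤n) ⟩
    4 * n + 2 * n            ≡⟨ solve (n ∷ []) ⟩
    3 * n + 3 * n            ∎

ShortDistinguisher : ℕ → Word → Word → Set
ShortDistinguisher n u v = ∃ λ x → Distinguishing x u v × 4 * length x ≤ 3 * n + 16

ShortlyDistinguishable : ℕ → Word → Word → Set
ShortlyDistinguishable n u v = length u ≡ n → length v ≡ n → ShortDistinguisher n u v

short-distinguisher-sym : ∀ {n u v} → ShortDistinguisher n v u → ShortDistinguisher n u v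
short-distinguisher-sym (x , inj₁ d , bound) = x , inj₂ d , bound
short-distinguisher-sym (x , inj₂ d , bound) = x , inj₁ d , bound

wlog-< : ∀ (f : Word → ℕ) (P : Word → Word → Set) → (∀ {u v} → P v u → P u v) →
         (∀ {u v} → f u < f v → P u v) → ∀ {u v} → f u ≢ f v → P u v
wlog-< f P sym-P lt⇒P {u} {v} ne with <-cmp (f u) (f v)
... | tri< lt _ _ = lt⇒P lt
... | tri≈ _ eq _ = contradiction eq ne
... | tri> _ _ gt = sym-P (lt⇒P gt)

power-short-distinguisher : ∀ c n {u v} → count c u < count c v →
  count c u + suc (count c u) ≤ n → ShortDistinguisher n u v
power-short-distinguisher c n {u} lt h =
  replicate (suc (count c u)) c , power-distinguishes c lt ,
  subst (λ m → 4 * m ≤ 3 * n + 16) (sym (length-replicate (suc (count c u))))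
        (power-length-bound (count c u) n h)

half-bound : ∀ {a b n} → a ≤ b → a + b < n → a + suc a ≤ n
half-bound {a} a≤b a+b<n =
  ≤-trans (≤-reflexive (+-suc a a)) (≤-trans (s≤s (+-monoʳ-≤ a a≤b)) a+b<n)

n0-differ : ∀ {n u v} → n0 u < n0 v → ShortlyDistinguishable n u v
n0-differ {n} {u} {v} lt lu lv = shorter-power (≤-total (n0 u) (n1 v))
  where
  a+b<n : n0 u + n1 v < n
  a+b<n = ≤-trans (+-monoˡ-< (n1 v) lt) (≤-reflexive (trans (n0+n1≡length v) lv))
  n1v<n1u : n1 v < n1 u
  n1v<n1u = +-cancelˡ-< (n0 u) (n1 v) (n1 u)
              (≤-trans a+b<n (≤-reflexive (sym (trans (n0+n1≡length u) lu))))
  shorter-power : n0 u ≤ n1 v ⊎ n1 v ≤ n0 u → ShortDistinguisher n u v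
  shorter-power (inj₁ a≤b) = power-short-distinguisher false n lt (half-bound a≤b a+b<n)
  shorter-power (inj₂ b≤a) = short-distinguisher-sym {n} {u} {v}
    (power-short-distinguisher true n n1v<n1u
      (half-bound b≤a (subst (_< n) (+-comm (n0 u) (n1 v)) a+b<n)))

blocks0-differ-few-zeros : ∀ {n u v} → blocks0 u < blocks0 v → n0 u + n0 u ≤ n →
                           ShortlyDistinguishable n u v
blocks0-differ-few-zeros {n} {u} {v} lt few lu lv with 8 * blocks0 u ≤? 3 * n + 8
... | yes short =
  alternating (suc (blocks0 u)) , inj₂ (alternating-subword _ v lt , not-in-u) ,
  alternating-length-bound (blocks0 u) n short
  where
  not-in-u : ¬ IsSubword (alternating (suc (blocks0 u))) u
  not-in-u s = 1+n≰n (subst (_≤ blocks0 u) (blocks0-alternating (suc (blocks0 u)))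
                            (subword-mono blocks0-rotate blocks0-mono-⊆ s))
... | no long =
  word , inj₁ (subword , not-in-v) ,
  sparse-length-bound (subst (λ m → length word + blocks0 u ≤ m + blocks0 word) lu
                             (blocks0-subword-defect subword))
                      blocks-≤n0 few (≰⇒> long)
  where
  open SparseSubword (sparseSubword u)
  not-in-v : ¬ IsSubword word v
  not-in-v s = <⇒≱ lt (+-cancelˡ-≤ (length word) _ _ (begin
    length word + blocks0 v  ≤⟨ blocks0-subword-defect s ⟩
    length v + blocks0 word  ≡⟨ cong (_+ blocks0 word) (trans lv (sym lu)) ⟩
    length u + blocks0 word  ≤⟨ defect ⟩
    length word + blocks0 u  ∎))
    where open ≤-Reasoning

n1+n1≤length : ∀ w → ¬ (n0 w + n0 w ≤ length w) → n1 w + n1 w ≤ length w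
n1+n1≤length w many = begin
  n1 w + n1 w  ≤⟨ +-monoˡ-≤ (n1 w) n1≤n0 ⟩
  n0 w + n1 w  ≡⟨ n0+n1≡length w ⟩
  length w     ∎
  where
  open ≤-Reasoning
  n1≤n0 : n1 w ≤ n0 w
  n1≤n0 = ≮⇒≥ λ n0<n1 →
    many (≤-trans (+-monoʳ-≤ (n0 w) (<⇒≤ n0<n1)) (≤-reflexive (n0+n1≡length w)))

blocks0-differ : ∀ {n u v} → blocks0 u < blocks0 v → ShortlyDistinguishable n u v
blocks0-differ {u = u} {v} lt refl lv with n0 u + n0 u ≤? length u
... | yes few  = blocks0-differ-few-zeros lt few refl lv
... | no  many with blocks0-differ-few-zeros {n = length u} {complement u} {complement v}
                      (subst₂ _<_ (sym (blocks0-complement u)) (sym (blocks0-complement v)) lt)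
                      (subst (λ m → m + m ≤ length u) (sym (n0-complement u)) (n1+n1≤length u many))
                      (length-complement u) (trans (length-complement v) lv)
...   | x , d , bound =
  complement x , distinguishing-complement d ,
  subst (λ m → 4 * m ≤ 3 * length u + 16) (sym (length-complement x)) bound

n1-determined : ∀ {u v} → length u ≡ length v → n0 u ≡ n0 v → n1 u ≡ n1 v
n1-determined {u} {v} lu≡lv n0≡ = +-cancelˡ-≡ (n0 u) (n1 u) (n1 v) (begin
  n0 u + n1 u  ≡⟨ n0+n1≡length u ⟩
  length u     ≡⟨ lu≡lv ⟩
  length v     ≡⟨ n0+n1≡length v ⟨
  n0 v + n1 v  ≡⟨ cong (_+ n1 v) n0≡ ⟨
  n0 u + n1 v  ∎)
  where open ≡-Reasoning

shortlyDistinguishable-sym : ∀ {n u v} → ShortlyDistinguishable n v u → ShortlyDistinguishable n u v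
shortlyDistinguishable-sym {n} {u} {v} d lu lv = short-distinguisher-sym {n} {u} {v} (d lv lu)

corollary1 : (n : ℕ) (u v : Word) → length u ≡ n → length v ≡ n →
             (n0 u ≢ n0 v ⊎ n1 u ≢ n1 v ⊎ blocks0 u ≢ blocks0 v) →
             ∃ λ x → Distinguishing x u v × 4 * length x ≤ 3 * n + 16
corollary1 n u v lu lv (inj₁ n0≢) =
  wlog-< n0 (ShortlyDistinguishable n) shortlyDistinguishable-sym n0-differ n0≢ lu lv
corollary1 n u v lu lv (inj₂ (inj₁ n1≢)) =
  wlog-< n0 (ShortlyDistinguishable n) shortlyDistinguishable-sym n0-differ
         (n1≢ ∘ n1-determined {u} {v} (trans lu (sym lv))) lu lv
corollary1 n u v lu lv (inj₂ (inj₂ blocks0≢)) =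
  wlog-< blocks0 (ShortlyDistinguishable n) shortlyDistinguishable-sym blocks0-differ blocks0≢ lu lv
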